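{- Let $r\geq 1$ and $n\geq r^2+r+1$ be integers, and let $G$ be a bipartite graph on $n$ vertices without isolated vertices such that $b(G)<\frac{1}{r}$. Let $$f(n,r)=\Big\lfloor\frac{n-1}{r+1}\Big\rfloor\Big(n-\Big\lfloor\frac{n-1}{r+1}\Big\rfloor\Big),\qquad g(n,r)=\Big\lfloor\frac{n-r-1}{2}\Big\rfloor\Big\lceil\frac{n-r-1}{2}\Big\rceil+r+1.$$ Then: (i) If $r=1$, then $e(G)\leq f(n,1)$, with equality if and only if $G\cong K_{n-\lfloor\frac{n-1}{2}\rfloor,\lfloor\frac{n-1}{2}\rfloor}$. (ii) If $r\geq 2$ and $f(n,r)>g(n,r)$, then $e(G)\leq f(n,r)$, with equality if and only if $G\cong K_{n-\lfloor\frac{n-1}{r+1}\rfloor,\lfloor\frac{n-1}{r+1}\rfloor}$. (iii) If $r\geq 2$ and $f(n,r)<g(n,r)$, then $e(G)\leq g(n,r)$, with equality if and only if $G\in\Big\{D\big(\lceil\frac{n-r-1}{2}\rceil,r+1;1,\lfloor\frac{n-r-1}{2}\rfloor-1\big),\ D\big(\lfloor\frac{n-r-1}{2}\rfloor,r+1;1,\lceil\frac{n-r-1}{2}\rceil-1\big)\Big\}$. (iv) If $r\geq 2$ and $f(n,r)=g(n,r)$, then $e(G)\leq f(n,r)$, with equality if and only if $G\in\Big\{K_{n-\lfloor\frac{n-1}{r+1}\rfloor,\lfloor\frac{n-1}{r+1}\rfloor},\ D\big(\lceil\frac{n-r-1}{2}\rceil,r+1;1,\lfloor\frac{n-r-1}{2}\rfloor-1\big),\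 D\big(\lfloor\frac{n-r-1}{2}\rfloor,r+1;1,\lceil\frac{n-r-1}{2}\rceil-1\big)\Big\}$.
   Context: All graphs are finite and simple; $e(G)$ is the number of edges. For $S\subseteq V(G)$, $N_G(S)$ is the union of the neighborhoods of vertices in $S$. The binding number of $G$ is $b(G)=\min\{|N_G(S)|/|S|:\emptyset\neq S\subseteq V(G),\ N_G(S)\neq V(G)\}$. $K_{a,b}$ is the complete bipartite graph with parts of sizes $a,b$. For positive integers $p_1,p_2,q_1,q_2$, the double nested graph $D(p_1,p_2;q_1,q_2)$ is the bipartite graph with parts $X=X_1\cup X_2$ and $Y=Y_1\cup Y_2$ (disjoint independent sets with $|X_i|=p_i$, $|Y_i|=q_i$), in which every vertex of $X_1$ is adjacent to every vertex of $Y_1\cup Y_2$, every vertex of $X_2$ is adjacent to every vertex of $Y_1$, and there are no other edges. -}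

module Defs where

open import Data.Nat using (ℕ; zero; suc; _+_; _*_; _∸_; _<_; _≤_; _<ᵇ_; _/_; ⌊_/2⌋; ⌈_/2⌉)
open import Data.Bool using (Bool; true; false; _∧_; _xor_; if_then_else_)
open import Data.Fin using (Fin; toℕ)
open import Data.Fin.Subset using (Subset; ∣_∣; Nonempty; ⊤)
open import Data.List using (List; allFin; map)
open import Data.Nat.ListAction using (sum)
open import Data.Bool.ListAction using (any)
open import Data.Vec using (lookup; tabulate)
open import Data.Product using (Σ; ∃; _×_; _,_)
open import Function.Bundles using (_↔_; Inverse)
open import Relation.Binary.PropositionalEquality using (_≡_; _≢_; refl)

record Graph (n : ℕ) : Set where
  field
    adj    : Fin n → Fin n → Bool
    sym    : ∀ i j → adj i j ≡ adj j i
    irrefl : ∀ i → adj i i ≡ false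
open Graph public

e : ∀ {n} → Graph n → ℕ
e {n} G = sum (map (λ i → sum (map (λ j →
            if adj G i j ∧ (toℕ i <ᵇ toℕ j) then 1 else 0) (allFin n))) (allFin n))

Bipartite : ∀ {n} → Graph n → Set
Bipartite {n} G = Σ (Fin n → Bool) λ c → ∀ i j → adj G i j ≡ true → c i ≢ c j

NoIsolated : ∀ {n} → Graph n → Set
NoIsolated {n} G = ∀ i → ∃ λ j → adj G i j ≡ true

N : ∀ {n} → Graph n → Subset n → Subset n
N {n} G S = tabulate λ j → any (λ i → lookup S i ∧ adj G i j) (allFin n)

-- b(G) < p / q, i.e. the minimum of |N(S)|/|S| over nonempty S with
-- N(S) ≠ V(G) is < p/q; unfolded: some such S has |N(S)|/|S| < p/q,
-- i.e. q·|N(S)| < p·|S|  (q > 0).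
BindingNumberLt : ∀ {n} → Graph n → ℕ → ℕ → Set
BindingNumberLt {n} G p q =
  ∃ λ (S : Subset n) → Nonempty S × N G S ≢ ⊤ × q * ∣ N G S ∣ < p * ∣ S ∣

_≅_ : ∀ {m n} → Graph m → Graph n → Set
_≅_ {m} {n} G H = Σ (Fin m ↔ Fin n) λ φ →
  ∀ i j → adj H (Inverse.to φ i) (Inverse.to φ j) ≡ adj G i j

private
  xor-comm : ∀ x y → x xor y ≡ y xor x
  xor-comm false false = refl
  xor-comm false true = refl
  xor-comm true false = refl
  xor-comm true true = refl
  xor-self : ∀ x → x xor x ≡ false
  xor-self false = refl
  xor-self true = refl

K : (a b : ℕ) → Graph (a + b)
K a b = record
  { adj = λ i j → (toℕ i <ᵇ a) xor (toℕ j <ᵇ a)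
  ; sym = λ i j → xor-comm (toℕ i <ᵇ a) (toℕ j <ᵇ a)
  ; irrefl = λ i → xor-self (toℕ i <ᵇ a) }

data Part : Set where X₁ X₂ Y₁ Y₂ : Part

private
  rel : Part → Part → Bool
  rel X₁ Y₁ = true
  rel X₁ Y₂ = true
  rel X₂ Y₁ = true
  rel Y₁ X₁ = true
  rel Y₂ X₁ = true
  rel Y₁ X₂ = true
  rel _ _ = false

  rel-sym : ∀ x y → rel x y ≡ rel y x
  rel-sym X₁ X₁ = refl
  rel-sym X₁ X₂ = refl
  rel-sym X₁ Y₁ = refl
  rel-sym X₁ Y₂ = refl
  rel-sym X₂ X₁ = refl
  rel-sym X₂ X₂ = refl
  rel-sym X₂ Y₁ = refl
  rel-sym X₂ Y₂ = refl
  rel-sym Y₁ X₁ = refl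
  rel-sym Y₁ X₂ = refl
  rel-sym Y₁ Y₁ = refl
  rel-sym Y₁ Y₂ = refl
  rel-sym Y₂ X₁ = refl
  rel-sym Y₂ X₂ = refl
  rel-sym Y₂ Y₁ = refl
  rel-sym Y₂ Y₂ = refl

  rel-irr : ∀ x → rel x x ≡ false
  rel-irr X₁ = refl
  rel-irr X₂ = refl
  rel-irr Y₁ = refl
  rel-irr Y₂ = refl

part : (p₁ p₂ q₁ : ℕ) → ℕ → Part
part p₁ p₂ q₁ k =
  if k <ᵇ p₁ then X₁ else
  if k <ᵇ p₁ + p₂ then X₂ else
  if k <ᵇ p₁ + p₂ + q₁ then Y₁ else Y₂

D : (p₁ p₂ q₁ q₂ : ℕ) → Graph (p₁ + p₂ + q₁ + q₂)
D p₁ p₂ q₁ q₂ = record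
  { adj = λ i j → rel (part p₁ p₂ q₁ (toℕ i)) (part p₁ p₂ q₁ (toℕ j))
  ; sym = λ i j → rel-sym (part p₁ p₂ q₁ (toℕ i)) (part p₁ p₂ q₁ (toℕ j))
  ; irrefl = λ i → rel-irr (part p₁ p₂ q₁ (toℕ i)) }

⌊n-1/r+1⌋ : ℕ → ℕ → ℕ
⌊n-1/r+1⌋ n r = (n ∸ 1) / suc r

f : ℕ → ℕ → ℕ
f n r = ⌊n-1/r+1⌋ n r * (n ∸ ⌊n-1/r+1⌋ n r)

g : ℕ → ℕ → ℕ
g n r = ⌊ n ∸ r ∸ 1 /2⌋ * ⌈ n ∸ r ∸ 1 /2⌉ + r + 1

Kf : (n r : ℕ) → Graph ((n ∸ ⌊n-1/r+1⌋ n r) + ⌊n-1/r+1⌋ n r)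
Kf n r = K (n ∸ ⌊n-1/r+1⌋ n r) (⌊n-1/r+1⌋ n r)

D₁ : (n r : ℕ) → Graph (⌈ n ∸ r ∸ 1 /2⌉ + (r + 1) + 1 + (⌊ n ∸ r ∸ 1 /2⌋ ∸ 1))
D₁ n r = D ⌈ n ∸ r ∸ 1 /2⌉ (r + 1) 1 (⌊ n ∸ r ∸ 1 /2⌋ ∸ 1)

D₂ : (n r : ℕ) → Graph (⌊ n ∸ r ∸ 1 /2⌋ + (r + 1) + 1 + (⌈ n ∸ r ∸ 1 /2⌉ ∸ 1))
D₂ n r = D ⌊ n ∸ r ∸ 1 /2⌋ (r + 1) 1 (⌈ n ∸ r ∸ 1 /2⌉ ∸ 1)

-- Split a deficient set P (r·|N(P)| < |P|) along the bipartition: N(P ∩ X) and N(P ∩ Y) are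
-- disjoint, so one half S is deficient too; swap the sides so that S ⊆ X, and let T = N(S).
-- As S has no neighbour in Y∖T, G is a spanning subgraph of the double nested graph on the parts
-- X∖S, S, T, Y∖T (sizes a, s, t, b), so e(G) ≤ a(t+b) + st with equality only if G ≅ D(a,s;t,b),
-- where a + s + t + b = n and rt < s. If b = 0 the bound is t(n−t) with (r+1)t < n, largest exactly
-- at t = ⌊(n−1)/(r+1)⌋, and then G is complete bipartite. If b = 1 it stays below f(n,r). If b ≥ 2,
-- moving the surplus of S beyond rt + 1 into X∖S and then lowering t to 1 never decreases it, and the
-- result (r+1) + xy with x + y = n − r − 1 is at most g(n,r), with equality only for D₁ and D₂;
-- for r = 1 this is still below f(n,1).
module Submission where

open import Data.Nat
  using (ℕ; zero; suc; _+_; _*_; _∸_; _/_; _≤_; _<_; _≥_; z≤n; s≤s; _<ᵇ_; ⌊_/2⌋; ⌈_/2⌉; _≤?_; _<?_; >-nonZero)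
open import Data.Nat.Properties
open import Data.Nat.DivMod using (m*n/n≡m; m/n*n≤m; /-monoˡ-≤)
open import Data.Nat.Tactic.RingSolver using (solve-∀)
open import Algebra.Properties.Semiring.Sum +-*-semiring
  using (sum; sum-syntax; sum-cong-≗; ∑-distrib-+; ∑-comm; sum-permute; sum-remove; *-distribˡ-sum)
open import Data.Bool using (Bool; true; false; not; _∧_; _xor_; if_then_else_)
open import Data.Bool.Properties as Bool
  using (T-≡; ¬-not; not-injective; xor-comm; xor-same; ∧-comm; ∧-identityʳ)
open import Data.Bool.ListAction using (any)
open import Data.Fin as Fin using (Fin; zero; suc)
open import Data.Fin.Properties using (toℕ-injective)
import Data.Fin.Permutation as Perm
open import Data.Fin.Subset using (Subset; ∣_∣)
import Data.List as List using (tabulate; map; allFin)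
open import Data.List.Properties using (map-tabulate)
open import Data.List.Relation.Unary.Any.Properties using (any⁺; any⁻; tabulate⁺; tabulate⁻)
import Data.Nat.ListAction as List
open import Data.Product using (Σ; ∃; _×_; _,_; proj₁; proj₂)
open import Data.Sum as Sum using (_⊎_; inj₁; inj₂)
open import Data.Vec using ([]; _∷_; lookup)
open import Data.Vec.Properties using (lookup∘tabulate)
open import Function using (_∘_; id)
open import Function.Bundles using (_↔_; _⇔_; Inverse; Equivalence; mk⇔)
open import Relation.Binary.Definitions using (DecidableEquality; tri<; tri≈; tri>)
open import Relation.Binary.PropositionalEquality
  using (_≡_; _≢_; refl; sym; trans; cong; cong₂; subst; subst₂; module ≡-Reasoning)
open import Relation.Nullary using (contradiction; Dec; does; yes; no)
open import Relation.Nullary.Decidable using (dec-true; map′)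
open import Defs renaming (sym to adj-sym)

𝟙 : Bool → ℕ
𝟙 b = if b then 1 else 0

𝟙-∧ : ∀ x y → 𝟙 (x ∧ y) ≡ 𝟙 x * 𝟙 y
𝟙-∧ true  y = sym (+-identityʳ (𝟙 y))
𝟙-∧ false y = refl

𝟙-injective : ∀ {x y} → 𝟙 x ≡ 𝟙 y → x ≡ y
𝟙-injective {true}  {true}  _ = refl
𝟙-injective {false} {false} _ = refl

∧≡true⇒ : ∀ {x y} → x ∧ y ≡ true → x ≡ true × y ≡ true
∧≡true⇒ {true} {true} _ = refl , refl

xor≡true⇒≢ : ∀ {x y} → x xor y ≡ true → x ≢ y
xor≡true⇒≢ {x} x⊕y refl = contradiction (trans (sym (xor-same x)) x⊕y) λ ()

does≡true⇒ : ∀ {A : Set} (a? : Dec A) → does a? ≡ true → A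
does≡true⇒ (yes a) _ = a

<⇒<ᵇ≡true : ∀ {m n} → m < n → (m <ᵇ n) ≡ true
<⇒<ᵇ≡true {zero}  {suc n} _         = refl
<⇒<ᵇ≡true {suc m} {suc n} (s≤s m<n) = <⇒<ᵇ≡true m<n

≥⇒<ᵇ≡false : ∀ {m n} → m ≥ n → (m <ᵇ n) ≡ false
≥⇒<ᵇ≡false {m}     {zero}  _         = refl
≥⇒<ᵇ≡false {suc m} {suc n} (s≤s m≥n) = ≥⇒<ᵇ≡false m≥n

sum-mono-≤ : ∀ {n} {f g : Fin n → ℕ} → (∀ i → f i ≤ g i) → sum f ≤ sum g
sum-mono-≤ {zero}  f≤g = z≤n
sum-mono-≤ {suc n} f≤g = +-mono-≤ (f≤g zero) (sum-mono-≤ (f≤g ∘ suc))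

sum-≤-≡⇒≗ : ∀ {n} {f g : Fin n → ℕ} → (∀ i → f i ≤ g i) → sum f ≡ sum g → ∀ i → f i ≡ g i
sum-≤-≡⇒≗ {suc n} {f} {g} f≤g ∑f≡∑g i = ≤-antisym (f≤g i) (+-cancelʳ-≤ _ (g i) (f i) (begin
  g i + sum (g ∘ Fin.punchIn i)  ≡⟨ sym (sum-remove g) ⟩
  sum g                          ≡⟨ sym ∑f≡∑g ⟩
  sum f                          ≡⟨ sum-remove f ⟩
  f i + sum (f ∘ Fin.punchIn i)  ≤⟨ +-monoʳ-≤ (f i) (sum-mono-≤ (f≤g ∘ Fin.punchIn i)) ⟩
  f i + sum (g ∘ Fin.punchIn i)  ∎))
  where open ≤-Reasoning

∑∑-distrib-+ : ∀ {m n} (f g : Fin m → Fin n → ℕ) →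
               ∑[ i < m ] ∑[ j < n ] (f i j + g i j) ≡ ∑[ i < m ] ∑[ j < n ] f i j + ∑[ i < m ] ∑[ j < n ] g i j
∑∑-distrib-+ {m} {n} f g = trans (sum-cong-≗ (λ i → ∑-distrib-+ (f i) (g i)))
                                 (∑-distrib-+ (λ i → ∑[ j < n ] f i j) (λ i → ∑[ j < n ] g i j))

∑∑-symmetrise : ∀ {n} (h a : Fin n → Fin n → ℕ) → (∀ i j → h i j ≡ a i j + a j i) →
                ∑[ i < n ] ∑[ j < n ] h i j ≡ 2 * ∑[ i < n ] ∑[ j < n ] a i j
∑∑-symmetrise {n} h a h≡a+aᵀ = begin
  ∑[ i < n ] ∑[ j < n ] h i j                                ≡⟨ sum-cong-≗ (λ i → sum-cong-≗ (h≡a+aᵀ i)) ⟩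
  ∑[ i < n ] ∑[ j < n ] (a i j + a j i)                      ≡⟨ ∑∑-distrib-+ a (λ i j → a j i) ⟩
  ∑[ i < n ] ∑[ j < n ] a i j + ∑[ i < n ] ∑[ j < n ] a j i  ≡⟨ cong (A +_) (sym (∑-comm a)) ⟩
  A + A                                                      ≡⟨ cong (A +_) (sym (+-identityʳ A)) ⟩
  2 * A                                                      ∎
  where
  open ≡-Reasoning
  A = ∑[ i < n ] ∑[ j < n ] a i j

sum-allFin : ∀ {n} (f : Fin n → ℕ) → List.sum (List.map f (List.allFin n)) ≡ sum f
sum-allFin f = trans (cong List.sum (map-tabulate id f)) (sum-tabulate f)
  where
  sum-tabulate : ∀ {n} (f : Fin n → ℕ) → List.sum (List.tabulate f) ≡ sum f
  sum-tabulate {zero}  f = refl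
  sum-tabulate {suc n} f = cong (f zero +_) (sum-tabulate (f ∘ suc))

count : ∀ {n} → (Fin n → Bool) → ℕ
count P = sum (𝟙 ∘ P)

count-pos⇒∃ : ∀ {n} (P : Fin n → Bool) → 0 < count P → ∃ λ i → P i ≡ true
count-pos⇒∃ {suc n} P pos with P zero in P0
... | true  = zero , P0
... | false = Data.Product.map suc id (count-pos⇒∃ (P ∘ suc) pos)

∃⇒count-pos : ∀ {n} (P : Fin n → Bool) i → P i ≡ true → 0 < count P
∃⇒count-pos {suc n} P i Pi = begin-strict
  0                                      <⟨ subst (λ b → 0 < 𝟙 b) (sym Pi) (s≤s z≤n) ⟩
  𝟙 (P i)                                ≤⟨ m≤m+n _ _ ⟩
  𝟙 (P i) + sum (𝟙 ∘ P ∘ Fin.punchIn i)  ≡⟨ sym (sum-remove (𝟙 ∘ P)) ⟩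
  count P                                ∎
  where open ≤-Reasoning

count-+-count-not : ∀ {n} (P : Fin n → Bool) → count P + count (not ∘ P) ≡ n
count-+-count-not {zero}  P = refl
count-+-count-not {suc n} P with P zero
... | true  = cong suc (count-+-count-not (P ∘ suc))
... | false = trans (+-suc _ _) (cong suc (count-+-count-not (P ∘ suc)))

count-<ᵇ : ∀ N A → A ≤ N → count {N} (λ k → Fin.toℕ k <ᵇ A) ≡ A
count-<ᵇ zero    zero    z≤n       = refl
count-<ᵇ (suc N) zero    _         = count-<ᵇ N zero z≤n
count-<ᵇ (suc N) (suc A) (s≤s A≤N) = cong suc (count-<ᵇ N A A≤N)

count-≮ᵇ : ∀ A B → count {A + B} (λ k → not (Fin.toℕ k <ᵇ A)) ≡ B
count-≮ᵇ A B = +-cancelˡ-≡ A _ _ (begin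
  A + count (not ∘ <A)         ≡⟨ cong (_+ count (not ∘ <A)) (sym (count-<ᵇ (A + B) A (m≤m+n A B))) ⟩
  count <A + count (not ∘ <A)  ≡⟨ count-+-count-not <A ⟩
  A + B                        ∎)
  where
  open ≡-Reasoning
  <A : Fin (A + B) → Bool
  <A k = Fin.toℕ k <ᵇ A

∑∑-𝟙-∧ : ∀ {m n} (P : Fin m → Bool) (Q : Fin n → Bool) →
         ∑[ i < m ] ∑[ j < n ] 𝟙 (P i ∧ Q j) ≡ count P * count Q
∑∑-𝟙-∧ {m} {n} P Q = begin
  ∑[ i < m ] ∑[ j < n ] 𝟙 (P i ∧ Q j)        ≡⟨ sum-cong-≗ (λ i → sum-cong-≗ (λ j → 𝟙-∧ (P i) (Q j))) ⟩
  ∑[ i < m ] ∑[ j < n ] (𝟙 (P i) * 𝟙 (Q j))  ≡⟨ sum-cong-≗ (λ i → sym (*-distribˡ-sum (𝟙 (P i)) (𝟙 ∘ Q))) ⟩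
  ∑[ i < m ] (𝟙 (P i) * count Q)             ≡⟨ sum-cong-≗ (λ i → *-comm (𝟙 (P i)) (count Q)) ⟩
  ∑[ i < m ] (count Q * 𝟙 (P i))             ≡⟨ sym (*-distribˡ-sum (count Q) (𝟙 ∘ P)) ⟩
  count Q * count P                          ≡⟨ *-comm (count Q) (count P) ⟩
  count P * count Q                          ∎
  where open ≡-Reasoning

∣∣≡count : ∀ {n} (S : Subset n) → ∣ S ∣ ≡ count (lookup S)
∣∣≡count []          = refl
∣∣≡count (true ∷ S)  = cong suc (∣∣≡count S)
∣∣≡count (false ∷ S) = ∣∣≡count S

degreeSum : ∀ {n} → Graph n → ℕ
degreeSum {n} G = ∑[ i < n ] ∑[ j < n ] 𝟙 (adj G i j)

degreeSum≡2*e : ∀ {n} (G : Graph n) → degreeSum G ≡ 2 * e G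
degreeSum≡2*e {n} G = trans (∑∑-symmetrise (λ i j → 𝟙 (adj G i j)) (λ i j → 𝟙 (forward i j)) split)
                            (cong (2 *_) (sym e≡∑∑))
  where
  forward : Fin n → Fin n → Bool
  forward i j = adj G i j ∧ (Fin.toℕ i <ᵇ Fin.toℕ j)
  e≡∑∑ : e G ≡ ∑[ i < n ] ∑[ j < n ] 𝟙 (forward i j)
  e≡∑∑ = trans (sum-allFin (λ i → List.sum (List.map (𝟙 ∘ forward i) (List.allFin n))))
               (sum-cong-≗ (λ i → sum-allFin (𝟙 ∘ forward i)))
  split : ∀ i j → 𝟙 (adj G i j) ≡ 𝟙 (forward i j) + 𝟙 (forward j i)
  split i j rewrite adj-sym G j i with adj G i j in ij | <-cmp (Fin.toℕ i) (Fin.toℕ j)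
  ... | false | _           = refl
  ... | true  | tri< i<j _ _ rewrite <⇒<ᵇ≡true i<j | ≥⇒<ᵇ≡false (<⇒≤ i<j) = refl
  ... | true  | tri> _ _ j<i rewrite <⇒<ᵇ≡true j<i | ≥⇒<ᵇ≡false (<⇒≤ j<i) = refl
  ... | true  | tri≈ _ i≡j _ with toℕ-injective i≡j
  ...   | refl = contradiction (trans (sym ij) (irrefl G i)) λ ()

ProperColouring : ∀ {n} → Graph n → (Fin n → Bool) → Set
ProperColouring {n} G c = ∀ i j → adj G i j ≡ true → c i ≢ c j

e≡∑-from-side : ∀ {n} (G : Graph n) (χ : Fin n → Bool) → ProperColouring G χ →
                e G ≡ ∑[ i < n ] ∑[ j < n ] 𝟙 (χ i ∧ adj G i j)
e≡∑-from-side G χ proper =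
  *-cancelˡ-≡ _ _ 2 (trans (sym (degreeSum≡2*e G))
    (∑∑-symmetrise (λ i j → 𝟙 (adj G i j)) (λ i j → 𝟙 (χ i ∧ adj G i j)) split))
  where
  split : ∀ i j → 𝟙 (adj G i j) ≡ 𝟙 (χ i ∧ adj G i j) + 𝟙 (χ j ∧ adj G j i)
  split i j rewrite adj-sym G j i with adj G i j in ij | χ i in χi | χ j in χj
  ... | false | false | false = refl
  ... | false | false | true  = refl
  ... | false | true  | false = refl
  ... | false | true  | true  = refl
  ... | true  | false | true  = refl
  ... | true  | true  | false = refl
  ... | true  | false | false = contradiction (trans χi (sym χj)) (proper i j ij)
  ... | true  | true  | true  = contradiction (trans χi (sym χj)) (proper i j ij)

≅⇒e≡ : ∀ {m n} {G : Graph m} {H : Graph n} → G ≅ H → e G ≡ e H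
≅⇒e≡ {m} {n} {G} {H} (φ , preserves) = *-cancelˡ-≡ _ _ 2 (begin
  2 * e G                                          ≡⟨ sym (degreeSum≡2*e G) ⟩
  ∑[ i < m ] ∑[ j < m ] 𝟙 (adj G i j)               ≡⟨ sum-cong-≗ (λ i → sum-cong-≗ (λ j → cong 𝟙 (sym (preserves i j)))) ⟩
  ∑[ i < m ] ∑[ j < m ] 𝟙 (adj H (to i) (to j))     ≡⟨ sum-cong-≗ (λ i → sym (sum-permute (𝟙 ∘ adj H (to i)) φ)) ⟩
  ∑[ i < m ] ∑[ j < n ] 𝟙 (adj H (to i) j)          ≡⟨ sym (sum-permute (λ i → ∑[ j < n ] 𝟙 (adj H i j)) φ) ⟩
  degreeSum H                                      ≡⟨ degreeSum≡2*e H ⟩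
  2 * e H                                          ∎)
  where
  open ≡-Reasoning
  to = Inverse.to φ

Subgraph : ∀ {n} → Graph n → Graph n → Set
Subgraph G H = ∀ i j → adj G i j ≡ true → adj H i j ≡ true

module _ {n} {G H : Graph n} (G⊆H : Subgraph G H) where

  private
    𝟙-adj-≤ : ∀ i j → 𝟙 (adj G i j) ≤ 𝟙 (adj H i j)
    𝟙-adj-≤ i j with adj G i j in ij
    ... | false = z≤n
    ... | true rewrite G⊆H i j ij = ≤-refl

  subgraph⇒e≤ : e G ≤ e H
  subgraph⇒e≤ = *-cancelˡ-≤ 2 (begin
    2 * e G      ≡⟨ sym (degreeSum≡2*e G) ⟩
    degreeSum G  ≤⟨ sum-mono-≤ (λ i → sum-mono-≤ (𝟙-adj-≤ i)) ⟩
    degreeSum H  ≡⟨ degreeSum≡2*e H ⟩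
    2 * e H      ∎)
    where open ≤-Reasoning

  subgraph∧e≡⇒adj≡ : e G ≡ e H → ∀ i j → adj G i j ≡ adj H i j
  subgraph∧e≡⇒adj≡ eG≡eH i j =
    𝟙-injective (sum-≤-≡⇒≗ (𝟙-adj-≤ i) (sum-≤-≡⇒≗ (λ i → sum-mono-≤ (𝟙-adj-≤ i)) same-degreeSum i) j)
    where
    same-degreeSum : degreeSum G ≡ degreeSum H
    same-degreeSum = trans (degreeSum≡2*e G) (trans (cong (2 *_) eG≡eH) (sym (degreeSum≡2*e H)))

nbr : ∀ {n} → Graph n → (Fin n → Bool) → Fin n → Bool
nbr {n} G P j = any (λ i → P i ∧ adj G i j) (List.allFin n)

lookup-N : ∀ {n} (G : Graph n) S j → lookup (N G S) j ≡ nbr G (lookup S) j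
lookup-N G S = lookup∘tabulate (nbr G (lookup S))

module _ {n} (G : Graph n) where

  adj⇒nbr : ∀ {P i j} → P i ≡ true → adj G i j ≡ true → nbr G P j ≡ true
  adj⇒nbr {i = i} Pi ij =
    Equivalence.to T-≡ (any⁺ _ (tabulate⁺ i (Equivalence.from T-≡ (cong₂ _∧_ Pi ij))))

  nbr⇒adj : ∀ {P j} → nbr G P j ≡ true → ∃ λ i → P i ≡ true × adj G i j ≡ true
  nbr⇒adj {P} {j} Nj with tabulate⁻ (any⁻ (λ i → P i ∧ adj G i j) _ (Equivalence.from T-≡ Nj))
  ... | i , Pi∧ij = i , ∧≡true⇒ (Equivalence.to T-≡ Pi∧ij)

  nbr-mono : ∀ {P Q j} → (∀ i → Q i ≡ true → P i ≡ true) → nbr G Q j ≡ true → nbr G P j ≡ true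
  nbr-mono Q⊆P Nj with nbr⇒adj Nj
  ... | i , Qi , ij = adj⇒nbr (Q⊆P i Qi) ij

  nbr-opposite : ∀ {c P x j} → ProperColouring G c → (∀ i → P i ≡ true → c i ≡ x) →
                 nbr G P j ≡ true → c j ≡ not x
  nbr-opposite proper P⊆x Nj with nbr⇒adj Nj
  ... | i , Pi , ij = ¬-not (λ cj≡x → proper _ _ ij (trans (P⊆x i Pi) (sym cj≡x)))

Deficient : ∀ {n} → Graph n → ℕ → (Fin n → Bool) → Set
Deficient G r S = r * count (nbr G S) < count S

binding<⇒deficient : ∀ {n r} (G : Graph n) → BindingNumberLt G 1 r → ∃ λ P → Deficient G r P
binding<⇒deficient {r = r} G (S , _ , _ , r*|N|<|S|) =
  lookup S , subst₂ (λ x y → r * x < y) |N|≡count (trans (+-identityʳ ∣ S ∣) (∣∣≡count S)) r*|N|<|S|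
  where
  |N|≡count : ∣ N G S ∣ ≡ count (nbr G (lookup S))
  |N|≡count = trans (∣∣≡count (N G S)) (sum-cong-≗ (cong 𝟙 ∘ lookup-N G S))

module _ {n} (G : Graph n) {c : Fin n → Bool} (proper : ProperColouring G c) (P : Fin n → Bool) where

  private
    P∩X P∩Y : Fin n → Bool
    P∩X i = P i ∧ not (c i)
    P∩Y i = P i ∧ c i

    P∩X⊆X : ∀ i → P∩X i ≡ true → c i ≡ false
    P∩X⊆X i = not-injective ∘ proj₂ ∘ ∧≡true⇒

    P∩Y⊆Y : ∀ i → P∩Y i ≡ true → c i ≡ true
    P∩Y⊆Y i = proj₂ ∘ ∧≡true⇒

    count-split : count P ≡ count P∩X + count P∩Y
    count-split = trans (sum-cong-≗ split) (∑-distrib-+ (𝟙 ∘ P∩X) (𝟙 ∘ P∩Y))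
      where
      split : ∀ i → 𝟙 (P i) ≡ 𝟙 (P∩X i) + 𝟙 (P∩Y i)
      split i with P i | c i
      ... | true  | true  = refl
      ... | true  | false = refl
      ... | false | _     = refl

    nbr-split : count (nbr G P∩X) + count (nbr G P∩Y) ≤ count (nbr G P)
    nbr-split = subst (_≤ count (nbr G P)) (∑-distrib-+ (𝟙 ∘ nbr G P∩X) (𝟙 ∘ nbr G P∩Y)) (sum-mono-≤ split)
      where
      split : ∀ j → 𝟙 (nbr G P∩X j) + 𝟙 (nbr G P∩Y j) ≤ 𝟙 (nbr G P j)
      split j with nbr G P∩X j in NXj | nbr G P∩Y j in NYj
      ... | false | false = z≤n
      ... | true  | false rewrite nbr-mono G {P} {P∩X} (λ i → proj₁ ∘ ∧≡true⇒) NXj = ≤-refl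
      ... | false | true  rewrite nbr-mono G {P} {P∩Y} (λ i → proj₁ ∘ ∧≡true⇒) NYj = ≤-refl
      ... | true  | true  with trans (sym (nbr-opposite G proper P∩X⊆X NXj)) (nbr-opposite G proper P∩Y⊆Y NYj)
      ...   | ()

  deficient-side : ∀ {r} → Deficient G r P →
    ∃ λ c′ → ∃ λ S → ProperColouring G c′ × (∀ i → S i ≡ true → c′ i ≡ false) × Deficient G r S
  deficient-side {r} P-deficient with r * count (nbr G P∩X) <? count P∩X | r * count (nbr G P∩Y) <? count P∩Y
  ... | yes P∩X-deficient | _ = c , P∩X , proper , P∩X⊆X , P∩X-deficient
  ... | no _ | yes P∩Y-deficient =
    not ∘ c , P∩Y , (λ i j ij → proper i j ij ∘ not-injective) , (λ i → cong not ∘ P∩Y⊆Y i) , P∩Y-deficient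
  ... | no ¬P∩X-deficient | no ¬P∩Y-deficient = contradiction P-deficient (≤⇒≯ (begin
    count P                                        ≡⟨ count-split ⟩
    count P∩X + count P∩Y                          ≤⟨ +-mono-≤ (≮⇒≥ ¬P∩X-deficient) (≮⇒≥ ¬P∩Y-deficient) ⟩
    r * count (nbr G P∩X) + r * count (nbr G P∩Y)  ≡⟨ sym (*-distribˡ-+ r _ _) ⟩
    r * (count (nbr G P∩X) + count (nbr G P∩Y))    ≤⟨ *-monoʳ-≤ r nbr-split ⟩
    r * count (nbr G P)                            ∎))
    where open ≤-Reasoning

BlowUp : ∀ {L : Set} {n} → (L → L → Bool) → (Fin n → L) → Graph n → Set
BlowUp R ℓ G = ∀ i j → adj G i j ≡ R (ℓ i) (ℓ j)

module Labelling {L : Set} (_≟_ : DecidableEquality L) where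

  fibre : ∀ {n} → (Fin n → L) → L → ℕ
  fibre ℓ x = count (λ i → does (ℓ i ≟ x))

  fibre-at-label : ∀ {n} (ℓ : Fin n → L) i → 0 < fibre ℓ (ℓ i)
  fibre-at-label ℓ i = ∃⇒count-pos (λ k → does (ℓ k ≟ ℓ i)) i (dec-true (ℓ i ≟ ℓ i) refl)

  relabel : ∀ {m n} (ℓ : Fin m → L) (ℓ′ : Fin n → L) → (∀ x → fibre ℓ x ≡ fibre ℓ′ x) →
            Σ (Fin m ↔ Fin n) λ φ → ∀ i → ℓ′ (Inverse.to φ i) ≡ ℓ i
  relabel {zero}  {zero}  ℓ ℓ′ _    = Perm.id , λ ()
  relabel {zero}  {suc n} ℓ ℓ′ same = contradiction (same (ℓ′ zero)) (<⇒≢ (fibre-at-label ℓ′ zero))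
  relabel {suc m} {zero}  ℓ ℓ′ same = contradiction (sym (same (ℓ zero))) (<⇒≢ (fibre-at-label ℓ zero))
  relabel {suc m} {suc n} ℓ ℓ′ same
    with count-pos⇒∃ _ (subst (0 <_) (same (ℓ zero)) (fibre-at-label ℓ zero))
  ... | j , ℓ′j-hit = Perm.insert zero j φ , matches
    where
    ℓ′j≡ℓ0 : ℓ′ j ≡ ℓ zero
    ℓ′j≡ℓ0 = does≡true⇒ (ℓ′ j ≟ ℓ zero) ℓ′j-hit
    same-rest : ∀ x → fibre (ℓ ∘ suc) x ≡ fibre (ℓ′ ∘ Fin.punchIn j) x
    same-rest x = +-cancelˡ-≡ (𝟙 (does (ℓ zero ≟ x))) _ _ (begin
      fibre ℓ x                                             ≡⟨ same x ⟩
      fibre ℓ′ x                                            ≡⟨ sum-remove (λ i → 𝟙 (does (ℓ′ i ≟ x))) ⟩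
      𝟙 (does (ℓ′ j ≟ x)) + fibre (ℓ′ ∘ Fin.punchIn j) x    ≡⟨ cong (λ y → 𝟙 (does (y ≟ x)) + _) ℓ′j≡ℓ0 ⟩
      𝟙 (does (ℓ zero ≟ x)) + fibre (ℓ′ ∘ Fin.punchIn j) x  ∎)
      where open ≡-Reasoning
    rest = relabel (ℓ ∘ suc) (ℓ′ ∘ Fin.punchIn j) same-rest
    φ = proj₁ rest
    matches : ∀ i → ℓ′ (Inverse.to (Perm.insert zero j φ) i) ≡ ℓ i
    matches zero    = ℓ′j≡ℓ0
    matches (suc k) = trans (cong ℓ′ (Perm.insert-punchIn zero j φ k)) (proj₂ rest k)

  blowUp-≅ : ∀ {m n R ℓ ℓ′} {G : Graph m} {H : Graph n} → BlowUp R ℓ G → BlowUp R ℓ′ H →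
             (∀ x → fibre ℓ x ≡ fibre ℓ′ x) → G ≅ H
  blowUp-≅ {R = R} {ℓ} {ℓ′} {G} {H} G-blowUp H-blowUp same with relabel ℓ ℓ′ same
  ... | φ , matches = φ , λ i j → begin
    adj H (Inverse.to φ i) (Inverse.to φ j)        ≡⟨ H-blowUp _ _ ⟩
    R (ℓ′ (Inverse.to φ i)) (ℓ′ (Inverse.to φ j))  ≡⟨ cong₂ R (matches i) (matches j) ⟩
    R (ℓ i) (ℓ j)                                  ≡⟨ sym (G-blowUp i j) ⟩
    adj G i j                                      ∎
    where open ≡-Reasoning

e-xor : ∀ {n} {G : Graph n} (χ : Fin n → Bool) → BlowUp _xor_ χ G → e G ≡ count χ * count (not ∘ χ)
e-xor {n} {G} χ G-blowUp = begin
  e G                                            ≡⟨ e≡∑-from-side G χ proper ⟩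
  ∑[ i < n ] ∑[ j < n ] 𝟙 (χ i ∧ adj G i j)      ≡⟨ sum-cong-≗ (λ i → sum-cong-≗ (λ j →
                                                      trans (cong (λ b → 𝟙 (χ i ∧ b)) (G-blowUp i j)) (cross (χ i) (χ j)))) ⟩
  ∑[ i < n ] ∑[ j < n ] 𝟙 (χ i ∧ not (χ j))      ≡⟨ ∑∑-𝟙-∧ χ (not ∘ χ) ⟩
  count χ * count (not ∘ χ)                      ∎
  where
  open ≡-Reasoning
  proper : ProperColouring G χ
  proper i j ij = xor≡true⇒≢ (trans (sym (G-blowUp i j)) ij)
  cross : ∀ x y → 𝟙 (x ∧ (x xor y)) ≡ 𝟙 (x ∧ not y)
  cross true  y = refl
  cross false y = refl

e-K : ∀ A B → e (K A B) ≡ A * B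
e-K A B = trans (e-xor {G = K A B} (λ k → Fin.toℕ k <ᵇ A) (λ _ _ → refl))
                (cong₂ _*_ (count-<ᵇ (A + B) A (m≤m+n A B)) (count-≮ᵇ A B))

blowUp-≅-K : ∀ {n} {G : Graph n} A B (χ : Fin n → Bool) → BlowUp _xor_ χ G →
             count χ ≡ A → count (not ∘ χ) ≡ B → G ≅ K A B
blowUp-≅-K {G = G} A B χ G-blowUp |χ| |¬χ| =
  blowUp-≅ {R = _xor_} {χ} {<A} {G} {K A B} G-blowUp (λ _ _ → refl) same-fibres
  where
  open Labelling Bool._≟_
  <A : Fin (A + B) → Bool
  <A k = Fin.toℕ k <ᵇ A
  fibre-true : ∀ {m} (ψ : Fin m → Bool) → fibre ψ true ≡ count ψ
  fibre-true ψ = sum-cong-≗ λ i → cong 𝟙 (does-≟-true (ψ i))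
    where
    does-≟-true : ∀ b → does (b Bool.≟ true) ≡ b
    does-≟-true true  = refl
    does-≟-true false = refl
  fibre-false : ∀ {m} (ψ : Fin m → Bool) → fibre ψ false ≡ count (not ∘ ψ)
  fibre-false ψ = sum-cong-≗ λ i → cong 𝟙 (does-≟-false (ψ i))
    where
    does-≟-false : ∀ b → does (b Bool.≟ false) ≡ not b
    does-≟-false true  = refl
    does-≟-false false = refl
  same-fibres : ∀ x → fibre χ x ≡ fibre <A x
  same-fibres true  = trans (fibre-true χ) (trans |χ| (sym (trans (fibre-true <A) (count-<ᵇ (A + B) A (m≤m+n A B)))))
  same-fibres false = trans (fibre-false χ) (trans |¬χ| (sym (trans (fibre-false <A) (count-≮ᵇ A B))))

isX inner : Part → Bool
isX X₁ = true
isX X₂ = true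
isX Y₁ = false
isX Y₂ = false
inner X₁ = false
inner X₂ = true
inner Y₁ = false
inner Y₂ = true

nested : Part → Part → Bool
nested x y = (isX x xor isX y) ∧ not (inner x ∧ inner y)

nested-sym : ∀ x y → nested x y ≡ nested y x
nested-sym x y = cong₂ _∧_ (xor-comm (isX x) (isX y)) (cong not (∧-comm (inner x) (inner y)))

nested-irrefl : ∀ x → nested x x ≡ false
nested-irrefl x = cong (_∧ not (inner x ∧ inner x)) (xor-same (isX x))

nested-without-Y₂ : ∀ x y → x ≢ Y₂ → y ≢ Y₂ → nested x y ≡ isX x xor isX y
nested-without-Y₂ X₁ y  _    _    = ∧-identityʳ _
nested-without-Y₂ Y₁ y  _    _    = ∧-identityʳ _
nested-without-Y₂ X₂ X₁ _    _    = refl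
nested-without-Y₂ X₂ X₂ _    _    = refl
nested-without-Y₂ X₂ Y₁ _    _    = refl
nested-without-Y₂ X₂ Y₂ _    y≢Y₂ = contradiction refl y≢Y₂
nested-without-Y₂ Y₂ y  x≢Y₂ _    = contradiction refl x≢Y₂

nestedGraph : ∀ {n} → (Fin n → Part) → Graph n
nestedGraph ℓ = record
  { adj    = λ i j → nested (ℓ i) (ℓ j)
  ; sym    = λ i j → nested-sym (ℓ i) (ℓ j)
  ; irrefl = λ i → nested-irrefl (ℓ i) }

index : Part → Fin 4
index X₁ = zero
index X₂ = suc zero
index Y₁ = suc (suc zero)
index Y₂ = suc (suc (suc zero))

index-injective : ∀ {x y} → index x ≡ index y → x ≡ y
index-injective {X₁} {X₁} _ = refl
index-injective {X₂} {X₂} _ = refl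
index-injective {Y₁} {Y₁} _ = refl
index-injective {Y₂} {Y₂} _ = refl

_≟ₚ_ : DecidableEquality Part
x ≟ₚ y = map′ index-injective (cong index) (index x Fin.≟ index y)

_==_ : Part → Part → Bool
x == y = does (x ≟ₚ y)

open Labelling _≟ₚ_

count-isX : ∀ {n} (ℓ : Fin n → Part) → count (isX ∘ ℓ) ≡ fibre ℓ X₁ + fibre ℓ X₂
count-isX ℓ = trans (sum-cong-≗ (split ∘ ℓ)) (∑-distrib-+ (λ i → 𝟙 (ℓ i == X₁)) (λ i → 𝟙 (ℓ i == X₂)))
  where
  split : ∀ x → 𝟙 (isX x) ≡ 𝟙 (x == X₁) + 𝟙 (x == X₂)
  split X₁ = refl
  split X₂ = refl
  split Y₁ = refl
  split Y₂ = refl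

count-not-isX : ∀ {n} (ℓ : Fin n → Part) → count (not ∘ isX ∘ ℓ) ≡ fibre ℓ Y₁ + fibre ℓ Y₂
count-not-isX ℓ = trans (sum-cong-≗ (split ∘ ℓ)) (∑-distrib-+ (λ i → 𝟙 (ℓ i == Y₁)) (λ i → 𝟙 (ℓ i == Y₂)))
  where
  split : ∀ x → 𝟙 (not (isX x)) ≡ 𝟙 (x == Y₁) + 𝟙 (x == Y₂)
  split X₁ = refl
  split X₂ = refl
  split Y₁ = refl
  split Y₂ = refl

fibres-sum : ∀ {n} (ℓ : Fin n → Part) → fibre ℓ X₁ + fibre ℓ X₂ + fibre ℓ Y₁ + fibre ℓ Y₂ ≡ n
fibres-sum ℓ = trans (+-assoc (fibre ℓ X₁ + fibre ℓ X₂) (fibre ℓ Y₁) (fibre ℓ Y₂))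
                     (trans (cong₂ _+_ (sym (count-isX ℓ)) (sym (count-not-isX ℓ))) (count-+-count-not (isX ∘ ℓ)))

X-edge-indicator : ∀ x y → 𝟙 (isX x ∧ nested x y) ≡
                   𝟙 (x == X₁ ∧ y == Y₁) + 𝟙 (x == X₁ ∧ y == Y₂) + 𝟙 (x == X₂ ∧ y == Y₁)
X-edge-indicator X₁ X₁ = refl
X-edge-indicator X₁ X₂ = refl
X-edge-indicator X₁ Y₁ = refl
X-edge-indicator X₁ Y₂ = refl
X-edge-indicator X₂ X₁ = refl
X-edge-indicator X₂ X₂ = refl
X-edge-indicator X₂ Y₁ = refl
X-edge-indicator X₂ Y₂ = refl
X-edge-indicator Y₁ y  = refl
X-edge-indicator Y₂ y  = refl

e-nested : ∀ {n} {G : Graph n} {ℓ} → BlowUp nested ℓ G →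
           e G ≡ fibre ℓ X₁ * (fibre ℓ Y₁ + fibre ℓ Y₂) + fibre ℓ X₂ * fibre ℓ Y₁
e-nested {n} {G} {ℓ} G-blowUp = begin
  e G                                                   ≡⟨ e≡∑-from-side G (isX ∘ ℓ) proper ⟩
  ∑∑ (λ i j → 𝟙 (isX (ℓ i) ∧ adj G i j))                ≡⟨ sum-cong-≗ (λ i → sum-cong-≗ (λ j →
                                                             trans (cong (λ b → 𝟙 (isX (ℓ i) ∧ b)) (G-blowUp i j))
                                                                   (X-edge-indicator (ℓ i) (ℓ j)))) ⟩
  ∑∑ (λ i j → X₁Y₁ i j + X₁Y₂ i j + X₂Y₁ i j)           ≡⟨ ∑∑-distrib-+ (λ i j → X₁Y₁ i j + X₁Y₂ i j) X₂Y₁ ⟩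
  ∑∑ (λ i j → X₁Y₁ i j + X₁Y₂ i j) + ∑∑ X₂Y₁             ≡⟨ cong (_+ ∑∑ X₂Y₁) (∑∑-distrib-+ X₁Y₁ X₁Y₂) ⟩
  ∑∑ X₁Y₁ + ∑∑ X₁Y₂ + ∑∑ X₂Y₁                            ≡⟨ cong₂ _+_ (cong₂ _+_ (∑∑-𝟙-∧ (is X₁) (is Y₁)) (∑∑-𝟙-∧ (is X₁) (is Y₂)))
                                                                       (∑∑-𝟙-∧ (is X₂) (is Y₁)) ⟩
  a * t + a * b + s * t                                 ≡⟨ cong (_+ s * t) (sym (*-distribˡ-+ a t b)) ⟩
  a * (t + b) + s * t                                   ∎
  where
  open ≡-Reasoning
  is : Part → Fin n → Bool
  is x i = ℓ i == x
  a = fibre ℓ X₁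
  s = fibre ℓ X₂
  t = fibre ℓ Y₁
  b = fibre ℓ Y₂
  ∑∑ : (Fin n → Fin n → ℕ) → ℕ
  ∑∑ h = ∑[ i < n ] ∑[ j < n ] h i j
  X₁Y₁ X₁Y₂ X₂Y₁ : Fin n → Fin n → ℕ
  X₁Y₁ i j = 𝟙 (is X₁ i ∧ is Y₁ j)
  X₁Y₂ i j = 𝟙 (is X₁ i ∧ is Y₂ j)
  X₂Y₁ i j = 𝟙 (is X₂ i ∧ is Y₁ j)
  proper : ProperColouring G (isX ∘ ℓ)
  proper i j ij = xor≡true⇒≢ (proj₁ (∧≡true⇒ (trans (sym (G-blowUp i j)) ij)))

D-label : ∀ p₁ p₂ q₁ q₂ → Fin (p₁ + p₂ + q₁ + q₂) → Part
D-label p₁ p₂ q₁ q₂ k = part p₁ p₂ q₁ (Fin.toℕ k)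

D-blowUp : ∀ p₁ p₂ q₁ q₂ → BlowUp nested (D-label p₁ p₂ q₁ q₂) (D p₁ p₂ q₁ q₂)
D-blowUp p₁ p₂ q₁ q₂ i j with D-label p₁ p₂ q₁ q₂ i | D-label p₁ p₂ q₁ q₂ j
... | X₁ | X₁ = refl
... | X₁ | X₂ = refl
... | X₁ | Y₁ = refl
... | X₁ | Y₂ = refl
... | X₂ | X₁ = refl
... | X₂ | X₂ = refl
... | X₂ | Y₁ = refl
... | X₂ | Y₂ = refl
... | Y₁ | X₁ = refl
... | Y₁ | X₂ = refl
... | Y₁ | Y₁ = refl
... | Y₁ | Y₂ = refl
... | Y₂ | X₁ = refl
... | Y₂ | X₂ = refl
... | Y₂ | Y₁ = refl
... | Y₂ | Y₂ = refl

blockSize : ℕ → ℕ → ℕ → ℕ → Part → ℕ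
blockSize p₁ p₂ q₁ q₂ X₁ = p₁
blockSize p₁ p₂ q₁ q₂ X₂ = p₂
blockSize p₁ p₂ q₁ q₂ Y₁ = q₁
blockSize p₁ p₂ q₁ q₂ Y₂ = q₂

fibre-D-label : ∀ p₁ p₂ q₁ q₂ x → fibre (D-label p₁ p₂ q₁ q₂) x ≡ blockSize p₁ p₂ q₁ q₂ x
fibre-D-label (suc p₁) p₂       q₁       q₂       X₁ = cong suc (fibre-D-label p₁ p₂ q₁ q₂ X₁)
fibre-D-label (suc p₁) p₂       q₁       q₂       X₂ = fibre-D-label p₁ p₂ q₁ q₂ X₂
fibre-D-label (suc p₁) p₂       q₁       q₂       Y₁ = fibre-D-label p₁ p₂ q₁ q₂ Y₁
fibre-D-label (suc p₁) p₂       q₁       q₂       Y₂ = fibre-D-label p₁ p₂ q₁ q₂ Y₂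
fibre-D-label zero     (suc p₂) q₁       q₂       X₁ = fibre-D-label 0 p₂ q₁ q₂ X₁
fibre-D-label zero     (suc p₂) q₁       q₂       X₂ = cong suc (fibre-D-label 0 p₂ q₁ q₂ X₂)
fibre-D-label zero     (suc p₂) q₁       q₂       Y₁ = fibre-D-label 0 p₂ q₁ q₂ Y₁
fibre-D-label zero     (suc p₂) q₁       q₂       Y₂ = fibre-D-label 0 p₂ q₁ q₂ Y₂
fibre-D-label zero     zero     (suc q₁) q₂       X₁ = fibre-D-label 0 0 q₁ q₂ X₁
fibre-D-label zero     zero     (suc q₁) q₂       X₂ = fibre-D-label 0 0 q₁ q₂ X₂
fibre-D-label zero     zero     (suc q₁) q₂       Y₁ = cong suc (fibre-D-label 0 0 q₁ q₂ Y₁)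
fibre-D-label zero     zero     (suc q₁) q₂       Y₂ = fibre-D-label 0 0 q₁ q₂ Y₂
fibre-D-label zero     zero     zero     (suc q₂) X₁ = fibre-D-label 0 0 0 q₂ X₁
fibre-D-label zero     zero     zero     (suc q₂) X₂ = fibre-D-label 0 0 0 q₂ X₂
fibre-D-label zero     zero     zero     (suc q₂) Y₁ = fibre-D-label 0 0 0 q₂ Y₁
fibre-D-label zero     zero     zero     (suc q₂) Y₂ = cong suc (fibre-D-label 0 0 0 q₂ Y₂)
fibre-D-label zero     zero     zero     zero     X₁ = refl
fibre-D-label zero     zero     zero     zero     X₂ = refl
fibre-D-label zero     zero     zero     zero     Y₁ = refl
fibre-D-label zero     zero     zero     zero     Y₂ = refl

e-D : ∀ p₁ p₂ q₁ q₂ → e (D p₁ p₂ q₁ q₂) ≡ p₁ * (q₁ + q₂) + p₂ * q₁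
e-D p₁ p₂ q₁ q₂ = trans (e-nested {G = D p₁ p₂ q₁ q₂} {D-label p₁ p₂ q₁ q₂} (D-blowUp p₁ p₂ q₁ q₂))
  (cong₂ _+_ (cong₂ _*_ (size X₁) (cong₂ _+_ (size Y₁) (size Y₂))) (cong₂ _*_ (size X₂) (size Y₁)))
  where size = fibre-D-label p₁ p₂ q₁ q₂

blowUp-≅-D : ∀ {n} {G : Graph n} {ℓ} p₁ p₂ q₁ q₂ → BlowUp nested ℓ G →
             fibre ℓ X₁ ≡ p₁ → fibre ℓ X₂ ≡ p₂ → fibre ℓ Y₁ ≡ q₁ → fibre ℓ Y₂ ≡ q₂ → G ≅ D p₁ p₂ q₁ q₂
blowUp-≅-D {G = G} {ℓ} p₁ p₂ q₁ q₂ G-blowUp |X₁| |X₂| |Y₁| |Y₂| =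
  blowUp-≅ {R = nested} {ℓ} {D-label p₁ p₂ q₁ q₂} {G} {D p₁ p₂ q₁ q₂} G-blowUp (D-blowUp p₁ p₂ q₁ q₂)
    (λ x → trans (sizes x) (sym (fibre-D-label p₁ p₂ q₁ q₂ x)))
  where
  sizes : ∀ x → fibre ℓ x ≡ blockSize p₁ p₂ q₁ q₂ x
  sizes X₁ = |X₁|
  sizes X₂ = |X₂|
  sizes Y₁ = |Y₁|
  sizes Y₂ = |Y₂|

module FourParts {n} (G : Graph n) {c : Fin n → Bool} (proper : ProperColouring G c)
                 (S : Fin n → Bool) (S⊆X : ∀ i → S i ≡ true → c i ≡ false) where

  T : Fin n → Bool
  T = nbr G S

  T⊆Y : ∀ j → T j ≡ true → c j ≡ true
  T⊆Y j = nbr-opposite G proper S⊆X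

  region : Fin n → Part
  region i = if c i then (if T i then Y₁ else Y₂) else (if S i then X₂ else X₁)

  a s t b : ℕ
  a = fibre region X₁
  s = fibre region X₂
  t = fibre region Y₁
  b = fibre region Y₂

  bound : ℕ
  bound = a * (t + b) + s * t

  a+s+t+b≡n : a + s + t + b ≡ n
  a+s+t+b≡n = fibres-sum region

  s≡|S| : s ≡ count S
  s≡|S| = sum-cong-≗ λ i → cong 𝟙 (in-X₂ i)
    where
    in-X₂ : ∀ i → region i == X₂ ≡ S i
    in-X₂ i with c i in ci | S i in Si | T i
    ... | true  | true  | _     = contradiction (trans (sym ci) (S⊆X i Si)) λ ()
    ... | true  | false | true  = refl
    ... | true  | false | false = refl
    ... | false | true  | _     = refl
    ... | false | false | _     = refl

  t≡|T| : t ≡ count T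
  t≡|T| = sum-cong-≗ λ i → cong 𝟙 (in-Y₁ i)
    where
    in-Y₁ : ∀ i → region i == Y₁ ≡ T i
    in-Y₁ i with c i in ci | S i | T i in Ti
    ... | true  | _     | true  = refl
    ... | true  | _     | false = refl
    ... | false | _     | true  = contradiction (trans (sym ci) (T⊆Y i Ti)) λ ()
    ... | false | true  | false = refl
    ... | false | false | false = refl

  nonempty-S⇒nonempty-T : NoIsolated G → 0 < s → 0 < t
  nonempty-S⇒nonempty-T no-isolated 0<s with count-pos⇒∃ S (subst (0 <_) s≡|S| 0<s)
  ... | i , Si with no-isolated i
  ...   | j , ij = subst (0 <_) (sym t≡|T|) (∃⇒count-pos T j (adj⇒nbr G Si ij))

  private
    X-to-Y : ∀ i j → c i ≡ false → adj G i j ≡ true → nested (region i) (region j) ≡ true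
    X-to-Y i j ci ij
      rewrite ci | ¬-not {c j} {false} (λ cj≡false → proper i j ij (trans ci (sym cj≡false)))
      with S i in Si | T j in Tj
    ... | true  | true  = refl
    ... | true  | false = contradiction (trans (sym Tj) (adj⇒nbr G Si ij)) λ ()
    ... | false | true  = refl
    ... | false | false = refl

  G⊆nestedGraph : Subgraph G (nestedGraph region)
  G⊆nestedGraph i j ij = by-side (c i) refl
    where
    by-side : ∀ x → c i ≡ x → nested (region i) (region j) ≡ true
    by-side false ci = X-to-Y i j ci ij
    by-side true  ci = trans (nested-sym (region i) (region j)) (X-to-Y j i cj (trans (adj-sym G j i) ij))
      where
      cj : c j ≡ false
      cj = trans (¬-not λ cj≡ci → proper i j ij (sym cj≡ci)) (cong not ci)

  private
    e-nestedGraph : e (nestedGraph region) ≡ bound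
    e-nestedGraph = e-nested {G = nestedGraph region} {region} (λ _ _ → refl)

  e≤bound : e G ≤ bound
  e≤bound = subst (e G ≤_) e-nestedGraph (subgraph⇒e≤ {G = G} {nestedGraph region} G⊆nestedGraph)

  e≡bound⇒blowUp : e G ≡ bound → BlowUp nested region G
  e≡bound⇒blowUp eq = subgraph∧e≡⇒adj≡ {G = G} {nestedGraph region} G⊆nestedGraph (trans eq (sym e-nestedGraph))

  e≡bound⇒≅D : e G ≡ bound → ∀ {p₁ p₂ q₁ q₂} → a ≡ p₁ → s ≡ p₂ → t ≡ q₁ → b ≡ q₂ → G ≅ D p₁ p₂ q₁ q₂
  e≡bound⇒≅D eq = blowUp-≅-D {G = G} {region} _ _ _ _ (e≡bound⇒blowUp eq)

  e≡bound⇒≅K : e G ≡ bound → b ≡ 0 → ∀ {A B} → a + s ≡ A → t ≡ B → G ≅ K A B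
  e≡bound⇒≅K eq b≡0 {A} {B} a+s≡A t≡B =
    blowUp-≅-K {G = G} A B (isX ∘ region) xor-blowUp (trans (count-isX region) a+s≡A) |Y|≡B
    where
    |Y|≡B : count (not ∘ isX ∘ region) ≡ B
    |Y|≡B = trans (count-not-isX region) (trans (cong (t +_) b≡0) (trans (+-identityʳ t) t≡B))
    no-Y₂ : ∀ i → region i ≢ Y₂
    no-Y₂ i i∈Y₂ = <⇒≢ (∃⇒count-pos _ i (dec-true (region i ≟ₚ Y₂) i∈Y₂)) (sym b≡0)
    xor-blowUp : BlowUp _xor_ (isX ∘ region) G
    xor-blowUp i j = trans (e≡bound⇒blowUp eq i j) (nested-without-Y₂ (region i) (region j) (no-Y₂ i) (no-Y₂ j))

a+b≡n⇒n∸a≡b : ∀ a {b n} → a + b ≡ n → n ∸ a ≡ b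
a+b≡n⇒n∸a≡b a {b} refl = m+n∸m≡n a b

squeeze : ∀ {x y z} → x ≤ y → y ≤ z → x ≡ z → x ≡ y × y ≡ z
squeeze x≤y y≤z refl = ≤-antisym x≤y y≤z , ≤-antisym y≤z x≤y

t*[n∸t]<u*[n∸u] : ∀ {t u n} → t < u → u + u ≤ n → t * (n ∸ t) < u * (n ∸ u)
t*[n∸t]<u*[n∸u] {t} {u} {n} t<u 2u≤n
  with j , refl ← m≤n⇒∃[o]m+o≡n t<u
  with z , refl ← m≤n⇒∃[o]m+o≡n 2u≤n = begin-strict
  t * (n ∸ t)                          ≡⟨ cong (t *_) (a+b≡n⇒n∸a≡b t (n≡t+[n∸t] t j z)) ⟩
  t * (t + δ + δ + z)                  <⟨ m<m+n _ (s≤s z≤n) ⟩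
  t * (t + δ + δ + z) + δ * (δ + z)    ≡⟨ gap t δ z ⟩
  (t + δ) * (t + δ + z)                ≡⟨ cong₂ _*_ (+-suc t j) (sym (a+b≡n⇒n∸a≡b (suc t + j) (n≡u+[n∸u] t j z))) ⟩
  u * (n ∸ u)                          ∎
  where
  open ≤-Reasoning
  δ = suc j
  n≡t+[n∸t] : ∀ t j z → t + (t + suc j + suc j + z) ≡ suc t + j + (suc t + j) + z
  n≡t+[n∸t] = solve-∀
  n≡u+[n∸u] : ∀ t j z → suc t + j + (t + suc j + z) ≡ suc t + j + (suc t + j) + z
  n≡u+[n∸u] = solve-∀
  gap : ∀ t δ z → t * (t + δ + δ + z) + δ * (δ + z) ≡ (t + δ) * (t + δ + z)
  gap = solve-∀

t*[r+1]<n⇒t≤q : ∀ {n} r {t} → t * suc r < n → t ≤ ⌊n-1/r+1⌋ n r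
t*[r+1]<n⇒t≤q {n} r {t} t*[r+1]<n = begin
  t                  ≡⟨ sym (m*n/n≡m t (suc r)) ⟩
  t * suc r / suc r  ≤⟨ /-monoˡ-≤ (suc r) (<⇒≤pred t*[r+1]<n) ⟩
  (n ∸ 1) / suc r    ∎
  where open ≤-Reasoning

q+q<n : ∀ {n} r → 1 ≤ r → 0 < n → ⌊n-1/r+1⌋ n r + ⌊n-1/r+1⌋ n r < n
q+q<n {n} r 1≤r 0<n = begin-strict
  q + q            ≡⟨ cong (q +_) (sym (+-identityʳ q)) ⟩
  2 * q            ≤⟨ *-monoˡ-≤ q (s≤s 1≤r) ⟩
  suc r * q        ≡⟨ *-comm (suc r) q ⟩
  q * suc r        ≤⟨ m/n*n≤m (n ∸ 1) (suc r) ⟩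
  n ∸ 1            <⟨ ∸-monoʳ-< (s≤s z≤n) 0<n ⟩
  n ∸ 0            ∎
  where
  open ≤-Reasoning
  q = ⌊n-1/r+1⌋ n r

f-bound : ∀ {n} r {t} → 1 ≤ r → t * suc r < n → t ≡ ⌊n-1/r+1⌋ n r ⊎ t * (n ∸ t) < f n r
f-bound {n} r 1≤r t*[r+1]<n with m≤n⇒m<n∨m≡n (t*[r+1]<n⇒t≤q r t*[r+1]<n)
... | inj₁ t<q = inj₂ (t*[n∸t]<u*[n∸u] t<q (<⇒≤ (q+q<n r 1≤r (≤-trans (s≤s z≤n) t*[r+1]<n))))
... | inj₂ t≡q = inj₁ t≡q

f-bound-≤ : ∀ {n} r {t} → 1 ≤ r → t * suc r < n → t * (n ∸ t) ≤ f n r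
f-bound-≤ {n} r {t} 1≤r t*[r+1]<n with f-bound r {t} 1≤r t*[r+1]<n
... | inj₁ t≡q  = ≤-reflexive (cong (λ t → t * (n ∸ t)) t≡q)
... | inj₂ <f   = <⇒≤ <f

⌈n/2⌉≤1+⌊n/2⌋ : ∀ n → ⌈ n /2⌉ ≤ suc ⌊ n /2⌋
⌈n/2⌉≤1+⌊n/2⌋ zero          = z≤n
⌈n/2⌉≤1+⌊n/2⌋ (suc zero)    = s≤s z≤n
⌈n/2⌉≤1+⌊n/2⌋ (suc (suc n)) = s≤s (⌈n/2⌉≤1+⌊n/2⌋ n)

halves-product-lower : ∀ {X Y m} → X ≤ ⌊ m /2⌋ → X + Y ≡ m →
                   (X ≡ ⌊ m /2⌋ × Y ≡ ⌈ m /2⌉) ⊎ X * Y < ⌊ m /2⌋ * ⌈ m /2⌉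
halves-product-lower {X} {Y} {m} X≤h X+Y≡m
  with m≤n⇒∃[o]m+o≡n X≤h | m≤n⇒∃[o]m+o≡n (⌊n/2⌋≤⌈n/2⌉ m)
... | zero , X+0≡h | _ = inj₁ (X≡h , +-cancelˡ-≡ X Y ⌈ m /2⌉ (trans X+Y≡m (sym h+h'≡m′)))
  where
  X≡h : X ≡ ⌊ m /2⌋
  X≡h = trans (sym (+-identityʳ X)) X+0≡h
  h+h'≡m′ : X + ⌈ m /2⌉ ≡ m
  h+h'≡m′ = trans (cong (_+ ⌈ m /2⌉) X≡h) (⌊n/2⌋+⌈n/2⌉≡n m)
... | suc j , X+J≡h | δ , h+δ≡h' = inj₂ (begin-strict
  X * Y                                  ≡⟨ cong (X *_) Y≡ ⟩
  X * (X + J + J + δ)                    <⟨ m<m+n _ (s≤s z≤n) ⟩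
  X * (X + J + J + δ) + J * (J + δ)      ≡⟨ gap X J δ ⟩
  (X + J) * (X + J + δ)                  ≡⟨ cong₂ _*_ X+J≡h (trans (cong (_+ δ) X+J≡h) h+δ≡h') ⟩
  ⌊ m /2⌋ * ⌈ m /2⌉                      ∎)
  where
  open ≤-Reasoning
  J = suc j
  gap : ∀ X J δ → X * (X + J + J + δ) + J * (J + δ) ≡ (X + J) * (X + J + δ)
  gap = solve-∀
  regroup : ∀ X J δ → X + J + (X + J + δ) ≡ X + (X + J + J + δ)
  regroup = solve-∀
  Y≡ : Y ≡ X + J + J + δ
  Y≡ = +-cancelˡ-≡ X Y _ (begin-equality
    X + Y                     ≡⟨ X+Y≡m ⟩
    m                         ≡⟨ sym (⌊n/2⌋+⌈n/2⌉≡n m) ⟩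
    ⌊ m /2⌋ + ⌈ m /2⌉         ≡⟨ cong₂ _+_ (sym X+J≡h) (trans (sym h+δ≡h') (cong (_+ δ) (sym X+J≡h))) ⟩
    X + J + (X + J + δ)       ≡⟨ regroup X J δ ⟩
    X + (X + J + J + δ)       ∎)

halves-product : ∀ {X Y m} → X + Y ≡ m →
  X * Y < ⌊ m /2⌋ * ⌈ m /2⌉ ⊎ (X ≡ ⌊ m /2⌋ × Y ≡ ⌈ m /2⌉) ⊎ (X ≡ ⌈ m /2⌉ × Y ≡ ⌊ m /2⌋)
halves-product {X} {Y} {m} X+Y≡m with X ≤? ⌊ m /2⌋
... | yes X≤h with halves-product-lower X≤h X+Y≡m
...   | inj₁ halves = inj₂ (inj₁ halves)
...   | inj₂ XY<    = inj₁ XY<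
halves-product {X} {Y} {m} X+Y≡m | no X≰h with halves-product-lower Y≤h (trans (+-comm Y X) X+Y≡m)
  where
  Y≤h : Y ≤ ⌊ m /2⌋
  Y≤h = +-cancelʳ-≤ ⌈ m /2⌉ Y ⌊ m /2⌋ (begin
    Y + ⌈ m /2⌉          ≤⟨ +-monoʳ-≤ Y (≤-trans (⌈n/2⌉≤1+⌊n/2⌋ m) (≰⇒> X≰h)) ⟩
    Y + X                ≡⟨ trans (+-comm Y X) X+Y≡m ⟩
    m                    ≡⟨ sym (⌊n/2⌋+⌈n/2⌉≡n m) ⟩
    ⌊ m /2⌋ + ⌈ m /2⌉    ∎)
    where open ≤-Reasoning
...   | inj₁ (Y≡h , X≡h') = inj₂ (inj₂ (X≡h' , Y≡h))
...   | inj₂ YX<          = inj₁ (subst (_< ⌊ m /2⌋ * ⌈ m /2⌉) (*-comm Y X) YX<)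

halves-product-≤ : ∀ {X Y m} → X + Y ≡ m → X * Y ≤ ⌊ m /2⌋ * ⌈ m /2⌉
halves-product-≤ {X} {Y} {m} X+Y≡m with halves-product {X} {Y} X+Y≡m
... | inj₁ XY<hh'              = <⇒≤ XY<hh'
... | inj₂ (inj₁ (X≡h , Y≡h')) = ≤-reflexive (cong₂ _*_ X≡h Y≡h')
... | inj₂ (inj₂ (X≡h' , Y≡h)) = ≤-reflexive (trans (cong₂ _*_ X≡h' Y≡h) (*-comm ⌈ m /2⌉ ⌊ m /2⌋))

u*r*[1+v]≡u⇒u≡0 : ∀ {u r} v → 2 ≤ r → u * r * suc v ≡ u → u ≡ 0
u*r*[1+v]≡u⇒u≡0 {zero}  v _   _  = refl
u*r*[1+v]≡u⇒u≡0 {suc u} {r} v 2≤r eq = contradiction eq (>⇒≢ (begin-strict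
  suc u                <⟨ m<m+n (suc u) (s≤s z≤n) ⟩
  suc u + suc u        ≡⟨ cong (suc u +_) (sym (+-identityʳ (suc u))) ⟩
  2 * suc u            ≤⟨ *-monoˡ-≤ (suc u) 2≤r ⟩
  r * suc u            ≡⟨ *-comm r (suc u) ⟩
  suc u * r            ≤⟨ m≤m*n (suc u * r) (suc v) ⟩
  suc u * r * suc v    ∎))
  where open ≤-Reasoning

Halves : ℕ → ℕ → ℕ → Set
Halves m a b = (a ≡ ⌈ m /2⌉ × b ≡ ⌊ m /2⌋ ∸ 1) ⊎ (a ≡ ⌊ m /2⌋ × b ≡ ⌈ m /2⌉ ∸ 1)

g<f-at-r≡1 : ∀ {n} → 5 ≤ n → g n 1 < f n 1
g<f-at-r≡1 {n@(suc (suc m))} (s≤s (s≤s 3≤m)) = begin-strict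
  h * h' + 1 + 1       ≡⟨ shuffle h h' ⟩
  h' * h + 2           <⟨ +-monoʳ-< (h' * h) (≤-trans (n≤1+n 3) (*-monoˡ-≤ 2 2≤h')) ⟩
  h' * h + h' * 2      ≡⟨ sym (*-distribˡ-+ h' h 2) ⟩
  h' * (h + 2)         ≡⟨ cong (h' *_) (sym (a+b≡n⇒n∸a≡b h' h'+h+2≡n)) ⟩
  h' * (n ∸ h')        ≤⟨ f-bound-≤ 1 {h'} ≤-refl h'*2<n ⟩
  f n 1                ∎
  where
  open ≤-Reasoning
  h = ⌊ m /2⌋
  h' = ⌈ m /2⌉
  shuffle : ∀ h h' → h * h' + 1 + 1 ≡ h' * h + 2
  shuffle = solve-∀
  2≤h' : 2 ≤ h'
  2≤h' = ⌈n/2⌉-mono 3≤m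
  h'+h+2≡n : h' + (h + 2) ≡ n
  h'+h+2≡n = trans (sym (+-assoc h' h 2)) (trans (cong (_+ 2) (+-comm h' h))
               (trans (cong (_+ 2) (⌊n/2⌋+⌈n/2⌉≡n m)) (+-comm m 2)))
  h'*2<n : h' * 2 < n
  h'*2<n = s≤s (begin
    h' * 2            ≡⟨ *-comm h' 2 ⟩
    h' + (h' + 0)     ≡⟨ cong (h' +_) (+-identityʳ h') ⟩
    h' + h'           ≤⟨ +-monoˡ-≤ h' (⌈n/2⌉≤1+⌊n/2⌋ m) ⟩
    suc h + h'        ≡⟨ cong suc (⌊n/2⌋+⌈n/2⌉≡n m) ⟩
    suc m             ∎)

bound-b≡0 : ∀ {r n a s t} → 1 ≤ r → a + s + t + 0 ≡ n → r * t < s →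
  (t ≡ ⌊n-1/r+1⌋ n r × a * (t + 0) + s * t ≡ f n r) ⊎ a * (t + 0) + s * t < f n r
bound-b≡0 {r} {n} {a} {s} {t} 1≤r a+s+t≡n r*t<s =
  Sum.map (λ t≡q → t≡q , trans V≡t*[n∸t] (cong (λ t → t * (n ∸ t)) t≡q)) (subst (_< f n r) (sym V≡t*[n∸t]))
          (f-bound r {t} 1≤r t*[r+1]<n)
  where
  open ≤-Reasoning
  regroup : ∀ a s t → t + (a + s) ≡ a + s + t + 0
  regroup = solve-∀
  factor : ∀ a s t → a * (t + 0) + s * t ≡ t * (a + s)
  factor = solve-∀
  V≡t*[n∸t] : a * (t + 0) + s * t ≡ t * (n ∸ t)
  V≡t*[n∸t] = trans (factor a s t) (cong (t *_) (sym (a+b≡n⇒n∸a≡b t (trans (regroup a s t) a+s+t≡n))))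
  t*[r+1]<n : t * suc r < n
  t*[r+1]<n = begin
    suc (t * suc r)    ≡⟨ cong suc (*-comm t (suc r)) ⟩
    suc (t + r * t)    ≡⟨ cong suc (+-comm t (r * t)) ⟩
    suc (r * t) + t    ≤⟨ +-monoˡ-≤ t r*t<s ⟩
    s + t              ≤⟨ m≤n+m (s + t) a ⟩
    a + (s + t)        ≡⟨ trans (sym (+-assoc a s t)) (trans (sym (+-identityʳ _)) a+s+t≡n) ⟩
    n                  ∎

surplus-shift : ∀ {n a d k t b} → a + (k + d) + t + b ≡ n →
  (a + d) + k + t + b ≡ n × a * (t + b) + (k + d) * t + d * b ≡ (a + d) * (t + b) + k * t
surplus-shift {a = a} {d} {k} {t} {b} a+s+t+b≡n = trans (sym (regroup a d k t b)) a+s+t+b≡n , gap a d k t b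
  where
  regroup : ∀ a d k t b → a + (k + d) + t + b ≡ (a + d) + k + t + b
  regroup = solve-∀
  gap : ∀ a d k t b → a * (t + b) + (k + d) * t + d * b ≡ (a + d) * (t + b) + k * t
  gap = solve-∀

-- Compare with t(n−t) when A < t and with (t+1)(n−t−1) when r ≤ A; otherwise n ≤ r² + r.
bound-b≡1 : ∀ {r n A t} → 1 ≤ r → r * r + r + 1 ≤ n → A + suc (r * t) + t + 1 ≡ n →
            A * (t + 1) + suc (r * t) * t < f n r
bound-b≡1 {r} {n} {A} {t} 1≤r n-large A+s+t+1≡n with A <? t | r ≤? A
... | yes A<t | _ = begin-strict
  W                 <⟨ +-cancelʳ-< t W _ (begin-strict
                         W + t               ≡⟨ trans (gap r t A) (cong (λ x → t * x + A) (sym n∸t)) ⟩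
                         t * (n ∸ t) + A     <⟨ +-monoʳ-< (t * (n ∸ t)) A<t ⟩
                         t * (n ∸ t) + t     ∎) ⟩
  t * (n ∸ t)       ≤⟨ f-bound-≤ r {t} 1≤r (m+n≤o⇒m≤o _ (≤-reflexive (trans (regroup₁ r t A) A+s+t+1≡n))) ⟩
  f n r             ∎
  where
  open ≤-Reasoning
  W = A * (t + 1) + suc (r * t) * t
  gap : ∀ r t A → A * (t + 1) + suc (r * t) * t + t ≡ t * (suc (r * t) + A + 1) + A
  gap = solve-∀
  regroup₀ : ∀ r t A → t + (suc (r * t) + A + 1) ≡ A + suc (r * t) + t + 1
  regroup₀ = solve-∀
  regroup₁ : ∀ r t A → suc (t * suc r) + (A + 1) ≡ A + suc (r * t) + t + 1
  regroup₁ = solve-∀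
  n∸t : n ∸ t ≡ suc (r * t) + A + 1
  n∸t = a+b≡n⇒n∸a≡b t (trans (regroup₀ r t A) A+s+t+1≡n)
... | no _ | yes r≤A = begin-strict
  W                           <⟨ m<m+n W (s≤s z≤n) ⟩
  W + suc (r * t)             ≡⟨ gap r t A ⟩
  (t + 1) * (suc (r * t) + A) ≡⟨ cong ((t + 1) *_) (sym n∸[t+1]) ⟩
  (t + 1) * (n ∸ (t + 1))     ≤⟨ f-bound-≤ r {t + 1} 1≤r [t+1]*[r+1]<n ⟩
  f n r                       ∎
  where
  open ≤-Reasoning
  W = A * (t + 1) + suc (r * t) * t
  gap : ∀ r t A → A * (t + 1) + suc (r * t) * t + suc (r * t) ≡ (t + 1) * (suc (r * t) + A)
  gap = solve-∀
  regroup₀ : ∀ r t A → t + 1 + (suc (r * t) + A) ≡ A + suc (r * t) + t + 1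
  regroup₀ = solve-∀
  regroup₁ : ∀ r t → suc ((t + 1) * suc r) ≡ r + suc (r * t) + t + 1
  regroup₁ = solve-∀
  n∸[t+1] : n ∸ (t + 1) ≡ suc (r * t) + A
  n∸[t+1] = a+b≡n⇒n∸a≡b (t + 1) (trans (regroup₀ r t A) A+s+t+1≡n)
  [t+1]*[r+1]<n : (t + 1) * suc r < n
  [t+1]*[r+1]<n = begin
    suc ((t + 1) * suc r)          ≡⟨ regroup₁ r t ⟩
    r + suc (r * t) + t + 1        ≤⟨ +-monoˡ-≤ 1 (+-monoˡ-≤ t (+-monoˡ-≤ (suc (r * t)) r≤A)) ⟩
    A + suc (r * t) + t + 1        ≡⟨ A+s+t+1≡n ⟩
    n                              ∎
... | no A≮t | no r≰A = contradiction n-large (<⇒≱ (begin-strict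
  n                          ≡⟨ sym A+s+t+1≡n ⟩
  A + suc (r * t) + t + 1    ≡⟨ regroup₀ r t A ⟩
  suc A + suc r * t + 1      ≤⟨ +-monoˡ-≤ 1 (+-monoˡ-≤ (suc r * t) (≰⇒> r≰A)) ⟩
  r + suc r * t + 1          ≡⟨ regroup₁ r t ⟩
  suc r * suc t              ≤⟨ *-monoʳ-≤ (suc r) (≤-trans (s≤s (≮⇒≥ A≮t)) (≰⇒> r≰A)) ⟩
  suc r * r                  ≡⟨ regroup₂ r ⟩
  r * r + r                  <⟨ m<m+n (r * r + r) (s≤s z≤n) ⟩
  r * r + r + 1              ∎))
  where
  open ≤-Reasoning
  regroup₀ : ∀ r t A → A + suc (r * t) + t + 1 ≡ suc A + suc r * t + 1
  regroup₀ = solve-∀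
  regroup₁ : ∀ r t → r + suc r * t + 1 ≡ suc r * suc t
  regroup₁ = solve-∀
  regroup₂ : ∀ r → suc r * r ≡ r * r + r
  regroup₂ = solve-∀

bound-b≥2 : ∀ {r n A t b} → 1 ≤ r → A + suc (r * t) + t + b ≡ n → 1 ≤ t → 2 ≤ b →
  A * (t + b) + suc (r * t) * t ≤ g n r ×
  (2 ≤ r → A * (t + b) + suc (r * t) * t ≡ g n r → t ≡ 1 × Halves (n ∸ r ∸ 1) A b)
bound-b≥2 {r} {n} {A} {suc u} {suc (suc v)} 1≤r A+s+t+b≡n (s≤s z≤n) (s≤s (s≤s z≤n)) =
  ≤-trans W≤W₁ W₁≤g , extremal
  where
  open ≤-Reasoning
  t = suc u
  b = suc (suc v)
  m = n ∸ r ∸ 1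
  h = ⌊ m /2⌋
  h' = ⌈ m /2⌉
  W = A * (t + b) + suc (r * t) * t
  -- W₁ is the bound for t = 1, s = r + 1, a = X, b = Y − 1 (same n), and W₁ − W = u(r(b−1) − 1).
  X = u * r + A
  Y = t + b
  W₁ = X * Y + r + 1
  excess : ∀ r A u v → A * (suc u + suc (suc v)) + suc (r * suc u) * suc u + u * r * suc v ≡
                       (u * r + A) * (suc u + suc (suc v)) + r + 1 + u
  excess = solve-∀
  regroup : ∀ r A u v → r + 1 + ((u * r + A) + (suc u + suc (suc v))) ≡ A + suc (r * suc u) + suc u + suc (suc v)
  regroup = solve-∀
  X+Y≡m : X + Y ≡ m
  X+Y≡m = sym (trans (∸-+-assoc n r 1) (a+b≡n⇒n∸a≡b (r + 1) (trans (regroup r A u v) A+s+t+b≡n)))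
  u≤u*r*[1+v] : u ≤ u * r * suc v
  u≤u*r*[1+v] = ≤-trans (m≤m*n u r {{>-nonZero 1≤r}}) (m≤m*n (u * r) (suc v))
  W≤W₁ : W ≤ W₁
  W≤W₁ = +-cancelʳ-≤ u W W₁ (begin
    W + u                ≤⟨ +-monoʳ-≤ W u≤u*r*[1+v] ⟩
    W + u * r * suc v    ≡⟨ excess r A u v ⟩
    W₁ + u               ∎)
  W₁≤g : W₁ ≤ g n r
  W₁≤g = +-monoˡ-≤ 1 (+-monoˡ-≤ r (halves-product-≤ {X} {Y} X+Y≡m))
  XY≡hh' : W₁ ≡ g n r → X * Y ≡ h * h'
  XY≡hh' W₁≡g = +-cancelʳ-≡ r _ _ (+-cancelʳ-≡ 1 _ _ W₁≡g)
  u≡0 : 2 ≤ r → W ≡ W₁ → u ≡ 0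
  u≡0 2≤r W≡W₁ = u*r*[1+v]≡u⇒u≡0 v 2≤r (+-cancelˡ-≡ W _ _ (trans (excess r A u v) (cong (_+ u) (sym W≡W₁))))
  extremal : 2 ≤ r → W ≡ g n r → t ≡ 1 × Halves m A b
  extremal 2≤r W≡g with squeeze W≤W₁ W₁≤g W≡g
  ... | W≡W₁ , W₁≡g with u≡0 2≤r W≡W₁ | halves-product {X} {Y} X+Y≡m
  ...   | refl | inj₁ XY<hh'              = contradiction (XY≡hh' W₁≡g) (<⇒≢ XY<hh')
  ...   | refl | inj₂ (inj₁ (X≡h , Y≡h')) = refl , inj₂ (X≡h , cong (_∸ 1) Y≡h')
  ...   | refl | inj₂ (inj₂ (X≡h' , Y≡h)) = refl , inj₁ (X≡h' , cong (_∸ 1) Y≡h)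

data BoundCase (r n a s t b : ℕ) : Set where
  below-f    : a * (t + b) + s * t < f n r → BoundCase r n a s t b
  K-extremal : b ≡ 0 → t ≡ ⌊n-1/r+1⌋ n r → a * (t + b) + s * t ≡ f n r → BoundCase r n a s t b
  D-bounded  : 2 ≤ r → a * (t + b) + s * t ≤ g n r →
               (a * (t + b) + s * t ≡ g n r → s ≡ r + 1 × t ≡ 1 × Halves (n ∸ r ∸ 1) a b) →
               BoundCase r n a s t b

bound-cases : ∀ {r n a s t b} → 1 ≤ r → r * r + r + 1 ≤ n → a + s + t + b ≡ n → r * t < s → 1 ≤ t →
              BoundCase r n a s t b
bound-cases {b = zero} 1≤r _ a+s+t+b≡n r*t<s _ with bound-b≡0 1≤r a+s+t+b≡n r*t<s
... | inj₁ (t≡q , V≡f) = K-extremal refl t≡q V≡f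
... | inj₂ V<f         = below-f V<f
-- For b ≥ 1, write s = rt + 1 + d and move the surplus d into X∖S.
bound-cases {r} {n} {a} {s} {t} {suc zero} 1≤r n-large a+s+t+b≡n r*t<s _
  with d , refl ← m≤n⇒∃[o]m+o≡n r*t<s =
  below-f (≤-<-trans (m+n≤o⇒m≤o _ (≤-reflexive gap)) (bound-b≡1 {r} {n} {a + d} {t} 1≤r n-large A+s+t+b≡n))
  where
  A+s+t+b≡n = proj₁ (surplus-shift {n} {a} {d} {suc (r * t)} {t} {1} a+s+t+b≡n)
  gap = proj₂ (surplus-shift {n} {a} {d} {suc (r * t)} {t} {1} a+s+t+b≡n)
bound-cases {suc zero} {n} {a} {s} {t@(suc t′)} {b@(suc (suc v))} 1≤r n-large a+s+t+b≡n r*t<s 1≤t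
  with d , refl ← m≤n⇒∃[o]m+o≡n r*t<s =
  below-f (≤-<-trans (m+n≤o⇒m≤o _ (≤-reflexive gap))
            (≤-<-trans (proj₁ (bound-b≥2 {1} {n} {a + d} 1≤r A+s+t+b≡n 1≤t (s≤s (s≤s z≤n)))) (g<f-at-r≡1 5≤n)))
  where
  A+s+t+b≡n = proj₁ (surplus-shift {n} {a} {d} {suc (1 * t)} {t} {b} a+s+t+b≡n)
  gap = proj₂ (surplus-shift {n} {a} {d} {suc (1 * t)} {t} {b} a+s+t+b≡n)
  regroup : ∀ a d t′ v → 5 + (a + d + t′ + t′ + v) ≡ a + d + suc (1 * suc t′) + suc t′ + suc (suc v)
  regroup = solve-∀
  5≤n : 5 ≤ n
  5≤n = m+n≤o⇒m≤o 5 (≤-reflexive (trans (regroup a d t′ v) A+s+t+b≡n))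
bound-cases {r@(suc (suc r′))} {n} {a} {s} {t} {b@(suc (suc v))} 1≤r n-large a+s+t+b≡n r*t<s 1≤t
  with d , refl ← m≤n⇒∃[o]m+o≡n r*t<s =
  D-bounded (s≤s (s≤s z≤n)) (≤-trans V≤W (proj₁ B₂)) extremal
  where
  A+s+t+b≡n = proj₁ (surplus-shift {n} {a} {d} {suc (r * t)} {t} {b} a+s+t+b≡n)
  gap = proj₂ (surplus-shift {n} {a} {d} {suc (r * t)} {t} {b} a+s+t+b≡n)
  V≤W = m+n≤o⇒m≤o _ (≤-reflexive gap)
  B₂ = bound-b≥2 {r} {n} {a + d} {t} {b} 1≤r A+s+t+b≡n 1≤t (s≤s (s≤s z≤n))
  extremal : a * (t + b) + (suc (r * t) + d) * t ≡ g n r →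
             suc (r * t) + d ≡ r + 1 × t ≡ 1 × Halves (n ∸ r ∸ 1) a b
  extremal V≡g with squeeze V≤W (proj₁ B₂) V≡g
  ... | V≡W , W≡g with proj₂ B₂ (s≤s (s≤s z≤n)) W≡g
                     | m*n≡0⇒m≡0 d b (+-cancelˡ-≡ _ (d * b) 0 (trans gap (trans (sym V≡W) (sym (+-identityʳ _)))))
  ...   | refl , halves | refl = s≡r+1 r , refl , subst (λ a → Halves (n ∸ r ∸ 1) a b) (+-identityʳ a) halves
    where
    s≡r+1 : ∀ r → suc (r * 1) + 0 ≡ r + 1
    s≡r+1 = solve-∀

Extremal : ℕ → ℕ → Set → Set
Extremal x u P = x ≤ u × (x ≡ u → P)

ExtremalStructure : (r n : ℕ) → Graph n → Set
ExtremalStructure r n G = Extremal (e G) (f n r) (G ≅ Kf n r)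
                        ⊎ (2 ≤ r × Extremal (e G) (g n r) (G ≅ D₁ n r ⊎ G ≅ D₂ n r))

extremal-structure : ∀ {r n} → 1 ≤ r → r * r + r + 1 ≤ n → (G : Graph n) →
                     Bipartite G → NoIsolated G → BindingNumberLt G 1 r → ExtremalStructure r n G
extremal-structure {r} {n} 1≤r n-large G (c , proper) no-isolated binding
  with binding<⇒deficient {r = r} G binding
... | P , P-deficient with deficient-side G proper P {r} P-deficient
... | c′ , S , proper′ , S⊆X , S-deficient = classify (bound-cases 1≤r n-large a+s+t+b≡n r*t<s 0<t)
  where
  open FourParts G proper′ S S⊆X
  r*t<s : r * t < s
  r*t<s = subst₂ (λ x y → r * x < y) (sym t≡|T|) (sym s≡|S|) S-deficient
  0<t : 0 < t
  0<t = nonempty-S⇒nonempty-T no-isolated (≤-<-trans z≤n r*t<s)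
  classify : BoundCase r n a s t b → ExtremalStructure r n G
  classify (below-f bound<f) =
    inj₁ (≤-trans e≤bound (<⇒≤ bound<f) , λ eG≡f → contradiction eG≡f (<⇒≢ (≤-<-trans e≤bound bound<f)))
  classify (K-extremal b≡0 t≡q bound≡f) =
    inj₁ (≤-trans e≤bound (≤-reflexive bound≡f) , λ eG≡f → e≡bound⇒≅K (trans eG≡f (sym bound≡f)) b≡0 a+s≡n∸q t≡q)
    where
    q = ⌊n-1/r+1⌋ n r
    a+s≡n∸q : a + s ≡ n ∸ q
    a+s≡n∸q = sym (a+b≡n⇒n∸a≡b q (begin
      q + (a + s)      ≡⟨ +-comm q (a + s) ⟩
      a + s + q        ≡⟨ sym (+-identityʳ _) ⟩
      a + s + q + 0    ≡⟨ sym (cong₂ (λ t b → a + s + t + b) t≡q b≡0) ⟩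
      a + s + t + b    ≡⟨ a+s+t+b≡n ⟩
      n                ∎))
      where open ≡-Reasoning
  classify (D-bounded 2≤r bound≤g shape) = inj₂ (2≤r , ≤-trans e≤bound bound≤g , D-shaped)
    where
    D-shaped : e G ≡ g n r → G ≅ D₁ n r ⊎ G ≅ D₂ n r
    D-shaped eG≡g with squeeze e≤bound bound≤g eG≡g
    ... | eG≡bound , bound≡g with shape bound≡g
    ...   | s≡r+1 , t≡1 , inj₁ (a≡ , b≡) = inj₁ (e≡bound⇒≅D eG≡bound a≡ s≡r+1 t≡1 b≡)
    ...   | s≡r+1 , t≡1 , inj₂ (a≡ , b≡) = inj₂ (e≡bound⇒≅D eG≡bound a≡ s≡r+1 t≡1 b≡)

e-Kf : ∀ n r → e (Kf n r) ≡ f n r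
e-Kf n r = trans (e-K (n ∸ q) q) (*-comm (n ∸ q) q)
  where q = ⌊n-1/r+1⌋ n r

2≤n∸r∸1 : ∀ {r n} → 2 ≤ r → r * r + r + 1 ≤ n → 2 ≤ n ∸ r ∸ 1
2≤n∸r∸1 {r} {n} 2≤r n-large = begin
  2                       ≤⟨ s≤s (s≤s z≤n) ⟩
  2 * 2                   ≤⟨ *-mono-≤ 2≤r 2≤r ⟩
  r * r                   ≡⟨ sym (trans (∸-+-assoc (r * r + r + 1) r 1) (a+b≡n⇒n∸a≡b (r + 1) (regroup r))) ⟩
  r * r + r + 1 ∸ r ∸ 1   ≤⟨ ∸-monoˡ-≤ 1 (∸-monoˡ-≤ r n-large) ⟩
  n ∸ r ∸ 1               ∎
  where
  open ≤-Reasoning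
  regroup : ∀ r → r + 1 + r * r ≡ r * r + r + 1
  regroup = solve-∀

e-D₁ : ∀ {r n} → 2 ≤ r → r * r + r + 1 ≤ n → e (D₁ n r) ≡ g n r
e-D₁ {r} {n} 2≤r n-large = begin
  e (D₁ n r)                        ≡⟨ e-D h' (r + 1) 1 (h ∸ 1) ⟩
  h' * (1 + (h ∸ 1)) + (r + 1) * 1  ≡⟨ cong (λ x → h' * x + (r + 1) * 1) (m+[n∸m]≡n 1≤h) ⟩
  h' * h + (r + 1) * 1              ≡⟨ regroup h h' r ⟩
  g n r                             ∎
  where
  open ≡-Reasoning
  h = ⌊ n ∸ r ∸ 1 /2⌋
  h' = ⌈ n ∸ r ∸ 1 /2⌉
  1≤h : 1 ≤ h
  1≤h = ⌊n/2⌋-mono (2≤n∸r∸1 2≤r n-large)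
  regroup : ∀ h h' r → h' * h + (r + 1) * 1 ≡ h * h' + r + 1
  regroup = solve-∀

e-D₂ : ∀ {r n} → 2 ≤ r → r * r + r + 1 ≤ n → e (D₂ n r) ≡ g n r
e-D₂ {r} {n} 2≤r n-large = begin
  e (D₂ n r)                        ≡⟨ e-D h (r + 1) 1 (h' ∸ 1) ⟩
  h * (1 + (h' ∸ 1)) + (r + 1) * 1  ≡⟨ cong (λ x → h * x + (r + 1) * 1) (m+[n∸m]≡n 1≤h') ⟩
  h * h' + (r + 1) * 1              ≡⟨ regroup h h' r ⟩
  g n r                             ∎
  where
  open ≡-Reasoning
  h = ⌊ n ∸ r ∸ 1 /2⌋
  h' = ⌈ n ∸ r ∸ 1 /2⌉
  1≤h' : 1 ≤ h'
  1≤h' = ⌈n/2⌉-mono (≤-trans (n≤1+n 1) (2≤n∸r∸1 2≤r n-large))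
  regroup : ∀ h h' r → h * h' + (r + 1) * 1 ≡ h * h' + r + 1
  regroup = solve-∀

extremal⇔ : ∀ {x u} {P : Set} → Extremal x u P → (P → x ≡ u) → x ≤ u × (x ≡ u ⇔ P)
extremal⇔ (x≤u , to) from = x≤u , mk⇔ to from

module _ {x u v : ℕ} {P Q : Set} where

  extremal-first : v < u → Extremal x u P ⊎ Extremal x v Q → Extremal x u P
  extremal-first _   (inj₁ ext)       = ext
  extremal-first v<u (inj₂ (x≤v , _)) = <⇒≤ x<u , λ x≡u → contradiction x≡u (<⇒≢ x<u)
    where x<u = ≤-<-trans x≤v v<u

  extremal-second : u < v → Extremal x u P ⊎ Extremal x v Q → Extremal x v Q
  extremal-second u<v (inj₁ (x≤u , _)) = <⇒≤ x<v , λ x≡v → contradiction x≡v (<⇒≢ x<v)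
    where x<v = ≤-<-trans x≤u u<v
  extremal-second _   (inj₂ ext)       = ext

  extremal-either : u ≡ v → Extremal x u P ⊎ Extremal x v Q → Extremal x u (P ⊎ Q)
  extremal-either _    (inj₁ (x≤u , to)) = x≤u , inj₁ ∘ to
  extremal-either refl (inj₂ (x≤v , to)) = x≤v , inj₂ ∘ to

theorem1p8 : (r n : ℕ) → 1 ≤ r → r * r + r + 1 ≤ n →
    (G : Graph n) → Bipartite G → NoIsolated G → BindingNumberLt G 1 r →
    (r ≡ 1 → e G ≤ f n 1 × (e G ≡ f n 1 ⇔ G ≅ Kf n 1))
    × (2 ≤ r → g n r < f n r → e G ≤ f n r × (e G ≡ f n r ⇔ G ≅ Kf n r))
    × (2 ≤ r → f n r < g n r → e G ≤ g n r × (e G ≡ g n r ⇔ (G ≅ D₁ n r ⊎ G ≅ D₂ n r)))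
    × (2 ≤ r → f n r ≡ g n r → e G ≤ f n r
         × (e G ≡ f n r ⇔ (G ≅ Kf n r ⊎ G ≅ D₁ n r ⊎ G ≅ D₂ n r)))
theorem1p8 r n 1≤r n-large G bipartite no-isolated binding =
    (λ { refl → extremal⇔ (only-K structure) Kf-edges })
  , (λ _ g<f → extremal⇔ (extremal-first g<f bounds) Kf-edges)
  , (λ 2≤r f<g → extremal⇔ (extremal-second f<g bounds) (D-edges 2≤r))
  , (λ 2≤r f≡g → extremal⇔ (extremal-either f≡g bounds)
                   Sum.[ Kf-edges , (λ G≅D → trans (D-edges 2≤r G≅D) (sym f≡g)) ])
  where
  structure = extremal-structure 1≤r n-large G bipartite no-isolated binding
  bounds = Sum.map₂ proj₂ structure
  only-K : ExtremalStructure 1 n G → Extremal (e G) (f n 1) (G ≅ Kf n 1)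
  only-K (inj₁ ext)           = ext
  only-K (inj₂ (s≤s () , _))
  Kf-edges : ∀ {r} → G ≅ Kf n r → e G ≡ f n r
  Kf-edges {r} G≅Kf = trans (≅⇒e≡ {G = G} {Kf n r} G≅Kf) (e-Kf n r)
  D-edges : 2 ≤ r → G ≅ D₁ n r ⊎ G ≅ D₂ n r → e G ≡ g n r
  D-edges 2≤r (inj₁ G≅D₁) = trans (≅⇒e≡ {G = G} {D₁ n r} G≅D₁) (e-D₁ 2≤r n-large)
  D-edges 2≤r (inj₂ G≅D₂) = trans (≅⇒e≡ {G = G} {D₂ n r} G≅D₂) (e-D₂ 2≤r n-large)
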